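{- For every $2$-degenerate graph $G$ on $n$ vertices, $\mathrm{ssp}(G) \leq n$.
   Context: All graphs are finite and simple. A graph $G$ is $2$-degenerate if every subgraph of $G$ contains a vertex of degree at most $2$. Given a collection $\mathcal{P}$ of paths in a graph $G$, two edges $e,f$ of $G$ are separated by $\mathcal{P}$ if there are paths $P_e,P_f\in\mathcal{P}$ such that $P_e$ contains $e$ but not $f$, and $P_f$ contains $f$ but not $e$. $\mathcal{P}$ is a strongly separating path system of $G$ if it separates every pair of distinct edges of $G$. $\mathrm{ssp}(G)$ denotes the minimum size of a strongly separating path system of $G$. -}

module Defs where

open import Data.Nat using (ℕ; _≤_)
open import Data.Fin using (Fin) renaming (_<_ to _<ᶠ_)
open import Data.Bool using (Bool; true; false; T)
open import Data.List using (List; []; _∷_; length; filterᵇ; allFin)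
open import Data.List.Relation.Unary.All using (All)
open import Data.List.Relation.Unary.Any using (Any)
open import Data.List.Relation.Unary.Linked using (Linked)
open import Data.List.Relation.Unary.Unique.Propositional using (Unique)
open import Data.Product using (Σ; ∃; _×_; _,_; proj₁)
open import Data.Sum using (_⊎_)
open import Relation.Binary.PropositionalEquality using (_≡_; _≢_)

record Graph (n : ℕ) : Set where
  field
    adj    : Fin n → Fin n → Bool
    symm   : ∀ u v → adj u v ≡ adj v u
    irrefl : ∀ v → adj v v ≡ false
open Graph public

record Subgraph {n : ℕ} (G : Graph n) : Set where
  field
    inS      : Fin n → Bool
    hadj     : Fin n → Fin n → Bool
    hsymm    : ∀ u v → hadj u v ≡ hadj v u
    hsub     : ∀ u v → T (hadj u v) → T (adj G u v)
    hclosed  : ∀ u v → T (hadj u v) → T (inS u) × T (inS v)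
open Subgraph public

degIn : ∀ {n} {G : Graph n} → Subgraph G → Fin n → ℕ
degIn H v = length (filterᵇ (hadj H v) (allFin _))

TwoDegenerate : ∀ {n} → Graph n → Set
TwoDegenerate {n} G =
  (H : Subgraph G) → (∃ λ (v : Fin n) → T (inS H v)) →
  ∃ λ (v : Fin n) → T (inS H v) × degIn H v ≤ 2

Edge : ∀ {n} → Graph n → Set
Edge {n} G = Σ (Fin n × Fin n) λ { (u , v) → u <ᶠ v × T (adj G u v) }

data Consecutive {n : ℕ} (x y : Fin n) : List (Fin n) → Set where
  here  : ∀ {zs} → Consecutive x y (x ∷ y ∷ zs)
  there : ∀ {z zs} → Consecutive x y zs → Consecutive x y (z ∷ zs)

record Path {n : ℕ} (G : Graph n) : Set where
  field
    verts    : List (Fin n)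
    nonempty : verts ≢ []
    distinct : Unique verts
    linked   : Linked (λ a b → T (adj G a b)) verts
open Path public

ContainsEdge : ∀ {n} {G : Graph n} → Path G → Edge G → Set
ContainsEdge P ((u , v) , _) =
  Consecutive u v (verts P) ⊎ Consecutive v u (verts P)

Separates : ∀ {n} {G : Graph n} → List (Path G) → Edge G → Edge G → Set
Separates 𝒫 e f =
  Any (λ P → ContainsEdge P e × (ContainsEdge P f → Data.Empty.⊥)) 𝒫 ×
  Any (λ P → ContainsEdge P f × (ContainsEdge P e → Data.Empty.⊥)) 𝒫
  where import Data.Empty

StronglySeparating : ∀ {n} {G : Graph n} → List (Path G) → Set
StronglySeparating {G = G} 𝒫 =
  (e f : Edge G) → proj₁ e ≢ proj₁ f → Separates 𝒫 e f

SspAtMost : ∀ {n} → Graph n → ℕ → Set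
SspAtMost G k = ∃ λ (𝒫 : List (Path G)) → StronglySeparating 𝒫 × length 𝒫 ≤ k

-- Induct on the vertex set: delete a vertex v of degree at most 2, and put it back into
-- a path system for the rest at the cost of one new path.  Besides separating all
-- edges, the system maintains two invariants: every edge lies on two paths, and every
-- vertex is an end of two paths (a one-vertex path ending twice at its vertex).  To put
-- v back, add the path [v]; then for each neighbour z add the edge vz, prolonging the
-- new path at its end v by z and an old path ending at z by v.  For the second
-- neighbour that old path must differ from the one used for the first, and it can be
-- chosen so because z is an end of two paths.  The new path carries only new edges;
-- an old edge lies on two paths, one of which avoids any given new edge; and two new
-- edges are told apart by the two prolonged old paths.

module Submission where

open import Level using (Level; 0ℓ)
open import Data.Bool using (T)
open import Data.Empty using (⊥-elim)
open import Data.Fin using (Fin; zero; suc; _≟_)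
open import Data.Fin.Properties using (suc-injective; <-asym)
open import Data.Fin.Subset using (Subset; ⊤; ⁅_⁆; _-_; ∣_∣; _⊂_) renaming (_∈_ to _∈ₛ_; _∉_ to _∉ₛ_)
open import Data.Fin.Subset.Induction using (⊂-wellFounded; Acc; acc)
open import Data.Fin.Subset.Properties
  using (_∈?_; nonempty?; ∈⊤; ∣⊤∣≡n; p─q⊆p; x∈p∧x≢y⇒x∈p-y; x∈p⇒p-x⊂p; x∈p⇒∣p-x∣<∣p∣)
open import Data.List
  using (List; []; _∷_; _++_; _∷ʳ_; [_]; head; last; foldl; length; filterᵇ; allFin; tabulate)
open import Data.List.Properties using (length-tabulate)
open import Data.List.Membership.Propositional using (_∈_; _∉_; find)
open import Data.List.Membership.Propositional.Properties using (∈-filter⁺; ∈-filter⁻; ∈-allFin)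
open import Data.List.Relation.Unary.All as All using (All; []; _∷_)
import Data.List.Relation.Unary.All.Properties as All
open import Data.List.Relation.Unary.AllPairs using ([]; _∷_)
open import Data.List.Relation.Unary.Any as Any using (Any; here; there)
import Data.List.Relation.Unary.Any.Properties as Any
open import Data.List.Relation.Unary.Linked as Linked using (Linked; [-]; _∷_; _∷′_)
import Data.List.Relation.Unary.Linked.Properties as Linked
open import Data.List.Relation.Unary.Unique.Propositional using (Unique)
import Data.List.Relation.Unary.Unique.Propositional.Properties as Unique
open import Data.Maybe using (Maybe; just)
open import Data.Maybe.Properties using (just-injective)
open import Data.Maybe.Relation.Binary.Connected using (Connected; just)
open import Data.Nat using (ℕ; zero; suc; _≤_; z≤n; s≤s)
open import Data.Nat.Properties using (≤-trans; ≤-reflexive)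
open import Data.Product using (Σ; ∃; ∃₂; _×_; _,_; proj₁; proj₂)
import Data.Product as Product
open import Data.Product.Properties using (≡-dec)
open import Data.Sum using (_⊎_; inj₁; inj₂)
import Data.Sum as Sum
open import Data.Vec using (here; there) renaming (_∷_ to _∷ᵥ_)
open import Data.Vec.Functional as Vector using (updateAt)
open import Data.Vec.Functional.Properties using (updateAt-updates; updateAt-minimal)
open import Function using (id; _∘_)
open import Function.Bundles using (mk⇔)
open import Relation.Binary using (Rel; Symmetric; DecidableEquality; _⇒_; _⇔_)
open import Relation.Binary.Construct.Union using (_∪_)
import Relation.Binary.Construct.Union as Union
open import Relation.Binary.PropositionalEquality
  using (_≡_; _≢_; refl; sym; trans; cong; subst; module ≡-Reasoning)
open import Relation.Nullary using (¬_; Dec; does; yes; no; _×-dec_; _⊎-dec_)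
open import Relation.Nullary.Decidable using (⌊_⌋; isYes≗does; does-⇔; toWitness; fromWitness; T?)
open import Relation.Unary using (Pred; _⊆_; _≐_; ｛_｝) renaming (_∪_ to _∪ᵥ_)
open import Relation.Unary.Properties using (≐-sym)
open import Defs

module _ {A : Set} (_≟ᴬ_ : DecidableEquality A) {P : A → Set} where

  avoid-one : ∀ {a₁ a₂} → a₁ ≢ a₂ → P a₁ → P a₂ → ∀ b → ∃ λ a → a ≢ b × P a
  avoid-one {a₁} {a₂} a₁≢a₂ Pa₁ Pa₂ b with a₁ ≟ᴬ b
  ... | no a₁≢b  = a₁ , a₁≢b , Pa₁
  ... | yes refl = a₂ , a₁≢a₂ ∘ sym , Pa₂

  avoid-two : ∀ {a₁ a₂} → a₁ ≢ a₂ → P a₁ → P a₂ → ∀ b c → ¬ (P b × P c) → ∃ λ a → a ≢ b × a ≢ c × P a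
  avoid-two {a₁} {a₂} a₁≢a₂ Pa₁ Pa₂ b c ¬PbPc with a₁ ≟ᴬ b | a₁ ≟ᴬ c | a₂ ≟ᴬ b | a₂ ≟ᴬ c
  ... | no a₁≢b  | no a₁≢c  | _        | _        = a₁ , a₁≢b , a₁≢c , Pa₁
  ... | _        | _        | no a₂≢b  | no a₂≢c  = a₂ , a₂≢b , a₂≢c , Pa₂
  ... | yes refl | _        | _        | yes refl = ⊥-elim (¬PbPc (Pa₁ , Pa₂))
  ... | _        | yes refl | yes refl | _        = ⊥-elim (¬PbPc (Pa₂ , Pa₁))
  ... | yes refl | _        | yes refl | _        = ⊥-elim (a₁≢a₂ refl)
  ... | _        | yes refl | _        | yes refl = ⊥-elim (a₁≢a₂ refl)

data Side : Set where
  front back : Side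

_≟ˢ_ : DecidableEquality Side
front ≟ˢ front = yes refl
front ≟ˢ back  = no λ ()
back  ≟ˢ front = no λ ()
back  ≟ˢ back  = yes refl

distinct-sides-exhaust : ∀ {t₁ t₂ : Side} → t₁ ≢ t₂ → ∀ s → s ≡ t₁ ⊎ s ≡ t₂
distinct-sides-exhaust {front} {front} t₁≢t₂ _ = ⊥-elim (t₁≢t₂ refl)
distinct-sides-exhaust {front} {back}  _ front = inj₁ refl
distinct-sides-exhaust {front} {back}  _ back  = inj₂ refl
distinct-sides-exhaust {back}  {front} _ front = inj₂ refl
distinct-sides-exhaust {back}  {front} _ back  = inj₁ refl
distinct-sides-exhaust {back}  {back}  t₁≢t₂ _ = ⊥-elim (t₁≢t₂ refl)

Slot : ℕ → Set
Slot m = Fin m × Side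

module _ {k : ℕ} where

  private
    V = Fin k
    variable
      ℓ : Level
      m : ℕ
      x y x′ y′ u v w z c : V
      p : List V
      s t : Side
      S S′ : Pred V 0ℓ
      E E′ : Rel V 0ℓ
      sys : Fin m → List V

  SamePair : V → V → V → V → Set
  SamePair x y u w = (x ≡ u × y ≡ w) ⊎ (x ≡ w × y ≡ u)

  samePair-swap : SamePair y x u w → SamePair x y u w
  samePair-swap (inj₁ (y≡u , x≡w)) = inj₂ (x≡w , y≡u)
  samePair-swap (inj₂ (y≡w , x≡u)) = inj₁ (x≡u , y≡w)

  samePair-trans : SamePair x y u w → SamePair x′ y′ u w → SamePair x y x′ y′
  samePair-trans (inj₁ (refl , refl)) (inj₁ (refl , refl)) = inj₁ (refl , refl)
  samePair-trans (inj₁ (refl , refl)) (inj₂ (refl , refl)) = inj₂ (refl , refl)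
  samePair-trans (inj₂ (refl , refl)) (inj₁ (refl , refl)) = inj₂ (refl , refl)
  samePair-trans (inj₂ (refl , refl)) (inj₂ (refl , refl)) = inj₁ (refl , refl)

  Link : V → V → Rel V 0ℓ
  Link u w x y = SamePair x y u w

  Covers : List V → V → V → Set
  Covers p x y = Consecutive x y p ⊎ Consecutive y x p

  covers-sym : Covers p x y → Covers p y x
  covers-sym = Sum.swap

  covers-resp : SamePair x y u w → Covers p u w → Covers p x y
  covers-resp (inj₁ (refl , refl)) = id
  covers-resp (inj₂ (refl , refl)) = covers-sym

  consecutive-∈ : Consecutive x y p → x ∈ p × y ∈ p
  consecutive-∈ here       = here refl , there (here refl)
  consecutive-∈ (there xy) = Product.map there there (consecutive-∈ xy)

  covers-∈ : Covers p x y → x ∈ p × y ∈ p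
  covers-∈ (inj₁ xy) = consecutive-∈ xy
  covers-∈ (inj₂ yx) = Product.swap (consecutive-∈ yx)

  ¬covers-avoiding : z ∉ p → x ≡ z ⊎ y ≡ z → ¬ Covers p x y
  ¬covers-avoiding z∉p (inj₁ refl) c = z∉p (proj₁ (covers-∈ c))
  ¬covers-avoiding z∉p (inj₂ refl) c = z∉p (proj₂ (covers-∈ c))

  ¬covers-[_] : ∀ z → ¬ Covers [ z ] x y
  ¬covers-[ z ] (inj₁ (there ()))
  ¬covers-[ z ] (inj₂ (there ()))

  covers-pair : Covers (u ∷ w ∷ []) x y → SamePair x y u w
  covers-pair (inj₁ here) = inj₁ (refl , refl)
  covers-pair (inj₂ here) = inj₂ (refl , refl)
  covers-pair (inj₁ (there (there ())))
  covers-pair (inj₂ (there (there ())))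

  linked-covers : {R : Rel V ℓ} → Symmetric R → Linked R p → Covers p x y → R x y
  linked-covers {R = R} R-sym l (inj₁ xy) = linked-consecutive l xy
    where
      linked-consecutive : ∀ {p} → Linked R p → Consecutive x y p → R x y
      linked-consecutive (r ∷ _) here       = r
      linked-consecutive (_ ∷ l) (there xy) = linked-consecutive l xy
      linked-consecutive [-]     (there ())
  linked-covers R-sym l (inj₂ yx) = R-sym (linked-covers R-sym l (inj₁ yx))

  consecutive? : ∀ (x y : V) p → Dec (Consecutive x y p)
  consecutive? x y []          = no λ ()
  consecutive? x y (_ ∷ [])    = no λ { (there ()) }
  consecutive? x y (a ∷ b ∷ p) with x ≟ a | y ≟ b | consecutive? x y (b ∷ p)
  ... | yes refl | yes refl | _       = yes here
  ... | _        | _        | yes xy  = yes (there xy)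
  ... | no x≢a   | _        | no ¬xy  = no λ { here → x≢a refl ; (there xy) → ¬xy xy }
  ... | yes _    | no y≢b   | no ¬xy  = no λ { here → y≢b refl ; (there xy) → ¬xy xy }

  covers? : ∀ p (x y : V) → Dec (Covers p x y)
  covers? p x y = consecutive? x y p ⊎-dec consecutive? y x p

  consecutive-++⁺ : ∀ q → Consecutive x y p → Consecutive x y (p ++ q)
  consecutive-++⁺ q here       = here
  consecutive-++⁺ q (there xy) = there (consecutive-++⁺ q xy)

  consecutive-∷ʳ⁻ : Consecutive x y (p ∷ʳ z) → Consecutive x y p ⊎ (last p ≡ just x × y ≡ z)
  consecutive-∷ʳ⁻ {p = []}        (there ())
  consecutive-∷ʳ⁻ {p = _ ∷ []}    here               = inj₂ (refl , refl)
  consecutive-∷ʳ⁻ {p = _ ∷ []}    (there (there ()))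
  consecutive-∷ʳ⁻ {p = _ ∷ _ ∷ _} here               = inj₁ here
  consecutive-∷ʳ⁻ {p = _ ∷ _ ∷ _} (there xy)         = Sum.map₁ there (consecutive-∷ʳ⁻ xy)

  consecutive-last-∷ʳ : last p ≡ just c → Consecutive c z (p ∷ʳ z)
  consecutive-last-∷ʳ {p = _ ∷ []}    refl = here
  consecutive-last-∷ʳ {p = _ ∷ y ∷ p} eq   = there (consecutive-last-∷ʳ {p = y ∷ p} eq)

  last-∷ʳ : ∀ p → last (p ∷ʳ z) ≡ just z
  last-∷ʳ         []          = refl
  last-∷ʳ         (_ ∷ [])    = refl
  last-∷ʳ {z = z} (_ ∷ y ∷ p) = last-∷ʳ {z = z} (y ∷ p)

  last-∈ : last p ≡ just c → c ∈ p
  last-∈ {p = _ ∷ []}    refl = here refl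
  last-∈ {p = _ ∷ _ ∷ _} eq   = there (last-∈ eq)

  tip : Side → List V → Maybe V
  tip front = head
  tip back  = last

  extendAt : Side → V → List V → List V
  extendAt front z p = z ∷ p
  extendAt back  z p = p ∷ʳ z

  tip-∈ : ∀ s → tip s p ≡ just c → c ∈ p
  tip-∈ {p = _ ∷ _} front refl = here refl
  tip-∈             back       = last-∈

  tip-extendAt : ∀ s p → tip s (extendAt s z p) ≡ just z
  tip-extendAt front p = refl
  tip-extendAt back  p = last-∷ʳ p

  tip-extendAt-other : ∀ s t → s ≢ t → tip s p ≡ just c → tip t (extendAt s z p) ≡ tip t p
  tip-extendAt-other             front front s≢t _ = ⊥-elim (s≢t refl)
  tip-extendAt-other {p = _ ∷ _} front back  _   _ = refl
  tip-extendAt-other {p = _ ∷ _} back  front _   _ = refl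
  tip-extendAt-other             back  back  s≢t _ = ⊥-elim (s≢t refl)

  covers-extendAt⁺ : ∀ s → Covers p x y → Covers (extendAt s z p) x y
  covers-extendAt⁺ front = Sum.map there there
  covers-extendAt⁺ back  = Sum.map (consecutive-++⁺ _) (consecutive-++⁺ _)

  covers-extendAt : ∀ s → tip s p ≡ just c → Covers (extendAt s z p) z c
  covers-extendAt {p = _ ∷ _} front refl = inj₁ here
  covers-extendAt             back  eq   = inj₂ (consecutive-last-∷ʳ eq)

  consecutive-extendAt⁻ : ∀ s → tip s p ≡ just c →
                          Consecutive x y (extendAt s z p) → Consecutive x y p ⊎ SamePair x y z c
  consecutive-extendAt⁻ {p = _ ∷ _} front refl here       = inj₂ (inj₁ (refl , refl))
  consecutive-extendAt⁻ {p = _ ∷ _} front refl (there xy) = inj₁ xy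
  consecutive-extendAt⁻             back  eq   xy with consecutive-∷ʳ⁻ xy
  ... | inj₁ xy′              = inj₁ xy′
  ... | inj₂ (last≡x , refl) = inj₂ (inj₂ (just-injective (trans (sym last≡x) eq) , refl))

  covers-extendAt⁻ : ∀ s → tip s p ≡ just c →
                     Covers (extendAt s z p) x y → Covers p x y ⊎ SamePair x y z c
  covers-extendAt⁻ s eq (inj₁ xy) = Sum.map₁ inj₁ (consecutive-extendAt⁻ s eq xy)
  covers-extendAt⁻ s eq (inj₂ yx) = Sum.map inj₂ samePair-swap (consecutive-extendAt⁻ s eq yx)

  linked-extendAt : {R : Rel V ℓ} → ∀ s → tip s p ≡ just c → R z c → R c z →
                    Linked R p → Linked R (extendAt s z p)
  linked-extendAt {p = _ ∷ _} front refl Rzc _ l = just Rzc ∷′ l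
  linked-extendAt {z = z} {R = R} back eq _ Rcz l =
    Linked.++⁺ l (subst (λ t → Connected R t (just z)) (sym eq) (just Rcz)) [-]

  unique-extendAt : ∀ s → z ∉ p → Unique p → Unique (extendAt s z p)
  unique-extendAt front z∉p u = All.¬Any⇒All¬ _ z∉p ∷ u
  unique-extendAt back  z∉p u = Unique.++⁺ u ([] ∷ []) λ { (z∈p , here refl) → z∉p z∈p }

  all-extendAt : {P : Pred V ℓ} → ∀ s → P z → All P p → All P (extendAt s z p)
  all-extendAt front Pz Pp = Pz ∷ Pp
  all-extendAt back  Pz Pp = All.∷ʳ⁺ Pp Pz

  nonempty-extendAt : ∀ s p → extendAt s z p ≢ []
  nonempty-extendAt front _       ()
  nonempty-extendAt back  []      ()
  nonempty-extendAt back  (_ ∷ _) ()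

  record IsPathIn (S : Pred V 0ℓ) (E : Rel V 0ℓ) (p : List V) : Set where
    field
      nonempty : p ≢ []
      distinct : Unique p
      linked   : Linked E p
      inside   : All S p
  open IsPathIn public

  isPathIn-[_] : S z → IsPathIn S E [ z ]
  isPathIn-[ Sz ] = record { nonempty = λ () ; distinct = [] ∷ [] ; linked = [-] ; inside = Sz ∷ [] }

  isPathIn-mono : S ⊆ S′ → E ⇒ E′ → IsPathIn S E p → IsPathIn S′ E′ p
  isPathIn-mono S⊆S′ E⇒E′ P = record
    { nonempty = nonempty P
    ; distinct = distinct P
    ; linked   = Linked.map E⇒E′ (linked P)
    ; inside   = All.map S⊆S′ (inside P)
    }

  isPathIn-extendAt : ∀ s → tip s p ≡ just c → S z → E z c → E c z → z ∉ p →
                      IsPathIn S E p → IsPathIn S E (extendAt s z p)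
  isPathIn-extendAt s eq Sz Ezc Ecz z∉p P = record
    { nonempty = nonempty-extendAt s _
    ; distinct = unique-extendAt s z∉p (distinct P)
    ; linked   = linked-extendAt s eq Ezc Ecz (linked P)
    ; inside   = all-extendAt s Sz (inside P)
    }

  -- The two ends of path i are the slots (i , front) and (i , back), so a one-vertex
  -- path ends twice at its vertex.
  tipAt : (Fin m → List V) → Slot m → Maybe V
  tipAt sys (i , s) = tip s (sys i)

  slots-differ : ∀ {ρ σ : Slot m} → tipAt sys ρ ≡ just x → tipAt sys σ ≡ just y → x ≢ y → ρ ≢ σ
  slots-differ tρ tσ x≢y refl = x≢y (just-injective (trans (sym tρ) tσ))

  EndTwice : (Fin m → List V) → V → Set
  EndTwice sys x = ∃₂ λ σ τ → σ ≢ τ × tipAt sys σ ≡ just x × tipAt sys τ ≡ just x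

  CoveredTwice : (Fin m → List V) → Rel V 0ℓ
  CoveredTwice sys x y = ∃₂ λ i j → i ≢ j × Covers (sys i) x y × Covers (sys j) x y

  record SeparatingSystem (S : Pred V 0ℓ) (E : Rel V 0ℓ) (sys : Fin m → List V) : Set where
    field
      isPath       : ∀ i → IsPathIn S E (sys i)
      separates    : ∀ {x y x′ y′} → E x y → E x′ y′ → ¬ SamePair x y x′ y′ →
                     ∃ λ i → Covers (sys i) x y × ¬ Covers (sys i) x′ y′
      coveredTwice : E ⇒ CoveredTwice sys
      endTwice     : ∀ {x} → S x → EndTwice sys x
  open SeparatingSystem public

  separatingSystem-resp : S ≐ S′ → E ⇔ E′ → SeparatingSystem S E sys → SeparatingSystem S′ E′ sys
  separatingSystem-resp (S⊆S′ , S′⊆S) (E⇒E′ , E′⇒E) 𝒫 = record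
    { isPath       = isPathIn-mono S⊆S′ E⇒E′ ∘ isPath 𝒫
    ; separates    = λ e f → separates 𝒫 (E′⇒E e) (E′⇒E f)
    ; coveredTwice = coveredTwice 𝒫 ∘ E′⇒E
    ; endTwice     = endTwice 𝒫 ∘ S′⊆S
    }

  emptySystem : (∀ {x} → ¬ S x) → (∀ {x y} → ¬ E x y) → SeparatingSystem S E Vector.[]
  emptySystem ¬S ¬E = record
    { isPath       = λ ()
    ; separates    = λ e → ⊥-elim (¬E e)
    ; coveredTwice = ⊥-elim ∘ ¬E
    ; endTwice     = ⊥-elim ∘ ¬S
    }

  addVertex : ∀ v → SeparatingSystem S E sys → SeparatingSystem (S ∪ᵥ ｛ v ｝) E ([ v ] Vector.∷ sys)
  addVertex v 𝒫 = record
    { isPath       = λ { zero → isPathIn-[ inj₂ refl ] ; (suc i) → isPathIn-mono inj₁ id (isPath 𝒫 i) }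
    ; separates    = λ e f e≉f → let i , cᵢ = separates 𝒫 e f e≉f in suc i , cᵢ
    ; coveredTwice = λ e → let i , j , i≢j , cᵢ , cⱼ = coveredTwice 𝒫 e in
                           suc i , suc j , i≢j ∘ suc-injective , cᵢ , cⱼ
    ; endTwice     = λ { (inj₁ Sx)   → shift (endTwice 𝒫 Sx)
                       ; (inj₂ refl) → (zero , front) , (zero , back) , (λ ()) , refl , refl }
    }
    where
      shift : EndTwice _ x → EndTwice ([ v ] Vector.∷ _) x
      shift ((i , s) , (j , t) , σ≢τ , tσ , tτ) =
        (suc i , s) , (suc j , t) , (λ { refl → σ≢τ refl }) , tσ , tτ

  endTwice-off-path : ∀ {i s} → EndTwice sys x → tipAt sys (i , s) ≡ just y → y ≢ x →
                      ∃ λ σ → proj₁ σ ≢ i × tipAt sys σ ≡ just x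
  endTwice-off-path {i = i} {s} (σ₁@(j₁ , t₁) , σ₂@(j₂ , t₂) , σ₁≢σ₂ , e₁ , e₂) y-at y≢x
    with j₁ ≟ i | j₂ ≟ i
  ... | no j₁≢i  | _        = σ₁ , j₁≢i , e₁
  ... | yes _    | no j₂≢i  = σ₂ , j₂≢i , e₂
  ... | yes refl | yes refl with distinct-sides-exhaust {t₁} {t₂} (λ { refl → σ₁≢σ₂ refl }) s
  ...   | inj₁ refl = ⊥-elim (y≢x (just-injective (trans (sym y-at) e₁)))
  ...   | inj₂ refl = ⊥-elim (y≢x (just-injective (trans (sym y-at) e₂)))

  -- Joins the end u of path i to the end w of path j by the new edge uw.  As paths i
  -- and j share no edge, one of them avoids any given old edge; and by coveredTwice
  -- every old edge also lies on a third path, which avoids uw.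
  module AddEdge
    {S : Pred V 0ℓ} {E : Rel V 0ℓ} (E-sym : Symmetric E)
    {m} {sys : Fin m → List V} (𝒫 : SeparatingSystem S E sys)
    {u w : V} {i j : Fin m} {s t : Side} (i≢j : i ≢ j)
    (u-at : tipAt sys (i , s) ≡ just u) (w-at : tipAt sys (j , t) ≡ just w)
    (w∉i : w ∉ sys i) (u∉j : u ∉ sys j) (¬Euw : ¬ E u w)
    (no-shared-edge : ∀ {x y} → E x y → Covers (sys i) x y → ¬ Covers (sys j) x y)
    where

    attach : Fin m → List V
    attach = updateAt (updateAt sys i (extendAt s w)) j (extendAt t u)

    attach-i : attach i ≡ extendAt s w (sys i)
    attach-i = trans (updateAt-minimal i j _ i≢j) (updateAt-updates i sys)

    attach-other : ∀ {l} → l ≢ i → l ≢ j → attach l ≡ sys l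
    attach-other {l} l≢i l≢j = trans (updateAt-minimal l j _ l≢j) (updateAt-minimal l i sys l≢i)

    private
      attach-j : attach j ≡ extendAt t u (sys j)
      attach-j = trans (updateAt-updates j _) (cong (extendAt t u) (updateAt-minimal j i sys (i≢j ∘ sym)))

      data View : Fin m → List V → Set where
        at-i      : View i (extendAt s w (sys i))
        at-j      : View j (extendAt t u (sys j))
        elsewhere : ∀ {l} → l ≢ i → l ≢ j → View l (sys l)

      view : ∀ l → View l (attach l)
      view l with l ≟ i | l ≟ j
      ... | yes refl | _        = subst (View i) (sym attach-i) at-i
      ... | no _     | yes refl = subst (View j) (sym attach-j) at-j
      ... | no l≢i   | no l≢j   = subst (View l) (sym (attach-other l≢i l≢j)) (elsewhere l≢i l≢j)

    tip-other : ∀ ρ → ρ ≢ (i , s) → ρ ≢ (j , t) → tipAt attach ρ ≡ tipAt sys ρ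
    tip-other (l , r) ρ≢σ ρ≢τ = go (view l)
      where
        go : ∀ {q} → View l q → tip r q ≡ tip r (sys l)
        go at-i            = tip-extendAt-other s r (λ { refl → ρ≢σ refl }) u-at
        go at-j            = tip-extendAt-other t r (λ { refl → ρ≢τ refl }) w-at
        go (elsewhere _ _) = refl

    private
      E⁺ : Rel V 0ℓ
      E⁺ = E ∪ Link u w

      tip-i : tipAt attach (i , s) ≡ just w
      tip-i rewrite attach-i = tip-extendAt s (sys i)

      tip-j : tipAt attach (j , t) ≡ just u
      tip-j rewrite attach-j = tip-extendAt t (sys j)

      u∈i : u ∈ sys i
      u∈i = tip-∈ s u-at

      w∈j : w ∈ sys j
      w∈j = tip-∈ t w-at

      u≢w : u ≢ w
      u≢w refl = w∉i u∈i

      covers⁺ : ∀ l → Covers (sys l) x y → Covers (attach l) x y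
      covers⁺ l = go (view l)
        where
          go : ∀ {q} → View l q → Covers (sys l) x y → Covers q x y
          go at-i            = covers-extendAt⁺ s
          go at-j            = covers-extendAt⁺ t
          go (elsewhere _ _) = id

      covers⁻ : ∀ l → Covers (attach l) x y → Covers (sys l) x y ⊎ Link u w x y
      covers⁻ l = go (view l)
        where
          go : ∀ {q} → View l q → Covers q x y → Covers (sys l) x y ⊎ Link u w x y
          go at-i            = Sum.map₂ Sum.swap ∘ covers-extendAt⁻ s u-at
          go at-j            = covers-extendAt⁻ t w-at
          go (elsewhere _ _) = inj₁

      covers-new-i : Covers (attach i) u w
      covers-new-i rewrite attach-i = covers-sym (covers-extendAt s u-at)

      covers-new-j : Covers (attach j) u w
      covers-new-j rewrite attach-j = covers-extendAt t w-at

      ¬link : E x y → ¬ Link u w x y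
      ¬link e (inj₁ (refl , refl)) = ¬Euw e
      ¬link e (inj₂ (refl , refl)) = ¬Euw (E-sym e)

      old-paths-miss-link : ∀ l → Link u w x y → ¬ Covers (sys l) x y
      old-paths-miss-link l uw c = ¬link (linked-covers E-sym (linked (isPath 𝒫 l)) c) uw

      still-misses : ∀ l → E x y → ¬ Covers (sys l) x y → ¬ Covers (attach l) x y
      still-misses l e ¬c c = Sum.[ ¬c , ¬link e ] (covers⁻ l c)

      covered-elsewhere : E x y → ∃ λ l → l ≢ i × l ≢ j × Covers (sys l) x y
      covered-elsewhere e = let l₁ , l₂ , l₁≢l₂ , c₁ , c₂ = coveredTwice 𝒫 e in
                            avoid-two _≟_ l₁≢l₂ c₁ c₂ i j λ (cᵢ , cⱼ) → no-shared-edge e cᵢ cⱼ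

      isPath⁺ : ∀ l → IsPathIn S E⁺ (attach l)
      isPath⁺ l = go (view l)
        where
          old : ∀ l → IsPathIn S E⁺ (sys l)
          old l = isPathIn-mono id inj₁ (isPath 𝒫 l)
          go : ∀ {q} → View l q → IsPathIn S E⁺ q
          go at-i            = isPathIn-extendAt s u-at (All.lookup (inside (isPath 𝒫 j)) w∈j)
                                 (inj₂ (inj₂ (refl , refl))) (inj₂ (inj₁ (refl , refl))) w∉i (old i)
          go at-j            = isPathIn-extendAt t w-at (All.lookup (inside (isPath 𝒫 i)) u∈i)
                                 (inj₂ (inj₁ (refl , refl))) (inj₂ (inj₂ (refl , refl))) u∉j (old j)
          go (elsewhere _ _) = old l

      separates⁺ : E⁺ x y → E⁺ x′ y′ → ¬ SamePair x y x′ y′ →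
                   ∃ λ l → Covers (attach l) x y × ¬ Covers (attach l) x′ y′
      separates⁺ (inj₁ e) (inj₁ f) e≉f =
        let l , c , ¬c = separates 𝒫 e f e≉f in l , covers⁺ l c , still-misses l f ¬c
      separates⁺ (inj₁ e) (inj₂ f) _ =
        let l , l≢i , l≢j , c = covered-elsewhere e in
        l , covers⁺ l c , old-paths-miss-link l f ∘ subst (λ q → Covers q _ _) (attach-other l≢i l≢j)
      separates⁺ {x′ = x′} {y′} (inj₂ e) (inj₁ f) _ with covers? (sys i) x′ y′
      ... | no ¬cᵢ = i , covers-resp e covers-new-i , still-misses i f ¬cᵢ
      ... | yes cᵢ = j , covers-resp e covers-new-j , still-misses j f (no-shared-edge f cᵢ)
      separates⁺ (inj₂ e) (inj₂ f) e≉f = ⊥-elim (e≉f (samePair-trans e f))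

      coveredTwice⁺ : E⁺ ⇒ CoveredTwice attach
      coveredTwice⁺ (inj₁ e) = let l₁ , l₂ , l₁≢l₂ , c₁ , c₂ = coveredTwice 𝒫 e in
                               l₁ , l₂ , l₁≢l₂ , covers⁺ l₁ c₁ , covers⁺ l₂ c₂
      coveredTwice⁺ (inj₂ e) = i , j , i≢j , covers-resp e covers-new-i , covers-resp e covers-new-j

      endTwice⁺ : S x → EndTwice attach x
      endTwice⁺ {x} Sx with endTwice 𝒫 Sx | x ≟ u | x ≟ w
      ... | σ₁ , σ₂ , σ₁≢σ₂ , t₁ , t₂ | yes refl | _ =
        let ρ , ρ≢σ , tρ = avoid-one (≡-dec _≟_ _≟ˢ_) σ₁≢σ₂ t₁ t₂ (i , s)
            ρ≢τ = slots-differ tρ w-at u≢w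
        in ρ , (j , t) , ρ≢τ , trans (tip-other ρ ρ≢σ ρ≢τ) tρ , tip-j
      ... | σ₁ , σ₂ , σ₁≢σ₂ , t₁ , t₂ | no _ | yes refl =
        let ρ , ρ≢τ , tρ = avoid-one (≡-dec _≟_ _≟ˢ_) σ₁≢σ₂ t₁ t₂ (j , t)
            ρ≢σ = slots-differ tρ u-at (u≢w ∘ sym)
        in ρ , (i , s) , ρ≢σ , trans (tip-other ρ ρ≢σ ρ≢τ) tρ , tip-i
      ... | σ₁ , σ₂ , σ₁≢σ₂ , t₁ , t₂ | no x≢u | no x≢w = σ₁ , σ₂ , σ₁≢σ₂ , kept σ₁ t₁ , kept σ₂ t₂
        where
          kept : ∀ σ → tipAt sys σ ≡ just x → tipAt attach σ ≡ just x
          kept σ tσ = trans (tip-other σ (slots-differ tσ u-at x≢u) (slots-differ tσ w-at x≢w)) tσ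

    separatingSystem : SeparatingSystem S (E ∪ Link u w) attach
    separatingSystem = record
      { isPath       = isPath⁺
      ; separates    = separates⁺
      ; coveredTwice = coveredTwice⁺
      ; endTwice     = endTwice⁺
      }

x∉p-x : ∀ {n} (p : Subset n) x → x ∉ₛ p - x
x∉p-x (_ ∷ᵥ p) zero    ()
x∉p-x (_ ∷ᵥ p) (suc x) (there x∈p-x) = x∉p-x p x x∈p-x

x∈p⇒p≐p-x∪x : ∀ {n} {p : Subset n} {x} → x ∈ₛ p → (_∈ₛ p) ≐ (_∈ₛ p - x) ∪ᵥ ｛ x ｝
x∈p⇒p≐p-x∪x {p = p} {x} x∈p = split , join
  where
    split : (_∈ₛ p) ⊆ (_∈ₛ p - x) ∪ᵥ ｛ x ｝
    split {y} y∈p with x ≟ y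
    ... | yes x≡y = inj₂ x≡y
    ... | no  x≢y = inj₁ (x∈p∧x≢y⇒x∈p-y y∈p (x≢y ∘ sym))
    join : (_∈ₛ p - x) ∪ᵥ ｛ x ｝ ⊆ (_∈ₛ p)
    join (inj₁ y∈p-x) = p─q⊆p p ⁅ x ⁆ y∈p-x
    join (inj₂ refl)  = x∈p

module _ {n : ℕ} (G : Graph n) where

  private
    V = Fin n
    variable
      m : ℕ
      x y v : V
      S S′ : Pred V 0ℓ
      E : Rel V 0ℓ

  Adj : Rel V 0ℓ
  Adj x y = T (adj G x y)

  adj-sym : Symmetric Adj
  adj-sym {x} {y} = subst T (symm G x y)

  adj-irrefl : ¬ Adj x x
  adj-irrefl {x} = subst T (irrefl G x)

  EdgeIn : Pred V 0ℓ → Rel V 0ℓ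
  EdgeIn S x y = S x × S y × Adj x y

  edgeIn-sym : Symmetric (EdgeIn S)
  edgeIn-sym (Sx , Sy , a) = Sy , Sx , adj-sym a

  edgeIn-resp : S ≐ S′ → EdgeIn S ⇒ EdgeIn S′
  edgeIn-resp (S⊆S′ , _) (Sx , Sy , a) = S⊆S′ Sx , S⊆S′ Sy , a

  -- A left fold, so that attachAll E v (a ∷ b ∷ []) is (E ∪ Link v a) ∪ Link v b on the
  -- nose: the edge relation reached by AddEdge for a and then for b.
  attachAll : Rel V 0ℓ → V → List V → Rel V 0ℓ
  attachAll E v = foldl (λ R z → R ∪ Link v z) E

  attachAll⁻ : ∀ N → attachAll E v N x y → E x y ⊎ Any (λ z → Link v z x y) N
  attachAll⁻ []      e = inj₁ e
  attachAll⁻ (z ∷ N) e with attachAll⁻ N e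
  ... | inj₁ (inj₁ e′) = inj₁ e′
  ... | inj₁ (inj₂ vz) = inj₂ (here vz)
  ... | inj₂ vN        = inj₂ (there vN)

  attachAll⁺ : ∀ N → E x y ⊎ Any (λ z → Link v z x y) N → attachAll E v N x y
  attachAll⁺ []      (inj₁ e)          = e
  attachAll⁺ (z ∷ N) (inj₁ e)          = attachAll⁺ N (inj₁ (inj₁ e))
  attachAll⁺ (z ∷ N) (inj₂ (here vz))  = attachAll⁺ N (inj₁ (inj₂ vz))
  attachAll⁺ (z ∷ N) (inj₂ (there vN)) = attachAll⁺ N (inj₂ vN)

  record ListsNeighbours (S′ : Pred V 0ℓ) (v : V) (N : List V) : Set where
    field
      neighbour⁺ : ∀ {z} → S′ z → Adj v z → z ∈ N
      neighbour⁻ : ∀ {z} → z ∈ N → S′ z × Adj v z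
  open ListsNeighbours

  module _ {S′ : Pred V 0ℓ} {v : V} {N : List V} (nbrs : ListsNeighbours S′ v N) where

    edgeIn-insert⁻ : EdgeIn (S′ ∪ᵥ ｛ v ｝) x y → EdgeIn S′ x y ⊎ Any (λ z → Link v z x y) N
    edgeIn-insert⁻ (inj₁ S′x  , inj₁ S′y  , a) = inj₁ (S′x , S′y , a)
    edgeIn-insert⁻ (inj₁ S′x  , inj₂ refl , a) =
      inj₂ (Any.map (λ { refl → inj₂ (refl , refl) }) (neighbour⁺ nbrs S′x (adj-sym a)))
    edgeIn-insert⁻ (inj₂ refl , inj₁ S′y  , a) =
      inj₂ (Any.map (λ { refl → inj₁ (refl , refl) }) (neighbour⁺ nbrs S′y a))
    edgeIn-insert⁻ (inj₂ refl , inj₂ refl , a) = ⊥-elim (adj-irrefl a)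

    edgeIn-insert⁺ : EdgeIn S′ x y ⊎ Any (λ z → Link v z x y) N → EdgeIn (S′ ∪ᵥ ｛ v ｝) x y
    edgeIn-insert⁺ (inj₁ (S′x , S′y , a)) = inj₁ S′x , inj₁ S′y , a
    edgeIn-insert⁺ (inj₂ vN) with find vN
    ... | z , z∈N , inj₁ (refl , refl) =
      let S′z , a = neighbour⁻ nbrs z∈N in inj₂ refl , inj₁ S′z , a
    ... | z , z∈N , inj₂ (refl , refl) =
      let S′z , a = neighbour⁻ nbrs z∈N in inj₁ S′z , inj₂ refl , adj-sym a

  module _ {S′ : Pred V 0ℓ} {v : V} (v∉S′ : ¬ S′ v)
           {sys : Fin m → List V} (𝒫 : SeparatingSystem S′ (EdgeIn S′) sys) where

    private
      v∉path : ∀ i → v ∉ sys i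
      v∉path i v∈i = v∉S′ (All.lookup (inside (isPath 𝒫 i)) v∈i)

      someEnd : S′ x → ∃ λ σ → tipAt sys σ ≡ just x
      someEnd S′x = let σ , _ , _ , e , _ = endTwice 𝒫 S′x in σ , e

      module FirstNeighbour {a} (S′a : S′ a) where
        ia : Fin m
        ia = proj₁ (proj₁ (someEnd S′a))

        sa : Side
        sa = proj₂ (proj₁ (someEnd S′a))

        a-at : tipAt sys (ia , sa) ≡ just a
        a-at = proj₂ (someEnd S′a)

        a∉[v] : a ∉ [ v ]
        a∉[v] (here refl) = v∉S′ S′a

        [v]-shares-nothing : ∀ {x y} → EdgeIn S′ x y → Covers [ v ] x y → ¬ Covers (sys ia) x y
        [v]-shares-nothing _ c = ⊥-elim (¬covers-[ v ] c)

        open AddEdge edgeIn-sym (addVertex v 𝒫)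
               {u = v} {w = a} {i = zero} {j = suc ia} {s = front} {t = sa}
               (λ ()) refl a-at a∉[v] (v∉path ia) (v∉S′ ∘ proj₁) [v]-shares-nothing public

      module SecondNeighbour {a b} (S′a : S′ a) (S′b : S′ b) (a≢b : a ≢ b) where
        module A = FirstNeighbour S′a

        σb : ∃ λ σ → proj₁ σ ≢ A.ia × tipAt sys σ ≡ just b
        σb = endTwice-off-path {s = A.sa} (endTwice 𝒫 S′b) A.a-at a≢b

        ib : Fin m
        ib = proj₁ (proj₁ σb)

        sb : Side
        sb = proj₂ (proj₁ σb)

        suc-ib≢suc-ia : suc ib ≢ suc A.ia
        suc-ib≢suc-ia = proj₁ (proj₂ σb) ∘ suc-injective

        b-at : tipAt A.attach (suc ib , sb) ≡ just b
        b-at = trans (A.tip-other (suc ib , sb) (λ ()) (suc-ib≢suc-ia ∘ cong proj₁)) (proj₂ (proj₂ σb))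

        b∉new : b ∉ A.attach zero
        b∉new rewrite A.attach-i = λ { (here refl) → a≢b refl ; (there (here refl)) → v∉S′ S′b }

        v∉ib : v ∉ A.attach (suc ib)
        v∉ib rewrite A.attach-other (λ ()) suc-ib≢suc-ia = v∉path ib

        ¬edge-vb : ¬ (EdgeIn S′ ∪ Link v a) v b
        ¬edge-vb (inj₁ (S′v , _))         = v∉S′ S′v
        ¬edge-vb (inj₂ (inj₁ (_ , refl))) = a≢b refl
        ¬edge-vb (inj₂ (inj₂ (refl , _))) = v∉S′ S′a

        new-at-v : Covers (A.attach zero) x y → x ≡ v ⊎ y ≡ v
        new-at-v {x} {y} c with covers-pair (subst (λ q → Covers q x y) A.attach-i c)
        ... | inj₁ (_ , y≡v) = inj₂ y≡v
        ... | inj₂ (x≡v , _) = inj₁ x≡v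

        new-shares-nothing : ∀ {x y} → (EdgeIn S′ ∪ Link v a) x y →
                             Covers (A.attach zero) x y → ¬ Covers (A.attach (suc ib)) x y
        new-shares-nothing _ c = ¬covers-avoiding v∉ib (new-at-v c)

        symmetric : Symmetric (EdgeIn S′ ∪ Link v a)
        symmetric = Union.symmetric {L = EdgeIn S′} {R = Link v a} edgeIn-sym samePair-swap

        open AddEdge symmetric A.separatingSystem
               {u = v} {w = b} {i = zero} {j = suc ib} {s = back} {t = sb}
               (λ ()) (cong (tip back) A.attach-i) b-at b∉new v∉ib ¬edge-vb new-shares-nothing public

    attachNeighbours : ∀ N → ListsNeighbours S′ v N → Unique N → length N ≤ 2 →
                       Σ (Fin (suc m) → List V) (SeparatingSystem (S′ ∪ᵥ ｛ v ｝) (attachAll (EdgeIn S′) v N))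
    attachNeighbours []              _    _                _ = _ , addVertex v 𝒫
    attachNeighbours (a ∷ [])        nbrs _                _ =
      _ , FirstNeighbour.separatingSystem (proj₁ (neighbour⁻ nbrs (here refl)))
    attachNeighbours (a ∷ b ∷ [])    nbrs ((a≢b ∷ []) ∷ _) _ =
      _ , SecondNeighbour.separatingSystem (proj₁ (neighbour⁻ nbrs (here refl)))
                                           (proj₁ (neighbour⁻ nbrs (there (here refl)))) a≢b
    attachNeighbours (_ ∷ _ ∷ _ ∷ _) _    _                (s≤s (s≤s ()))

  vertexStep : ∀ {S S′ : Pred V 0ℓ} {v} {sys : Fin m → List V} → S ≐ S′ ∪ᵥ ｛ v ｝ → ¬ S′ v →
               ∀ N → ListsNeighbours S′ v N → Unique N → length N ≤ 2 →
               SeparatingSystem S′ (EdgeIn S′) sys → Σ (Fin (suc m) → List V) (SeparatingSystem S (EdgeIn S))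
  vertexStep S≐S′∪v v∉S′ N nbrs unique deg≤2 𝒫 =
    let sys′ , 𝒫′ = attachNeighbours v∉S′ 𝒫 N nbrs unique deg≤2 in
    sys′ , separatingSystem-resp (≐-sym S≐S′∪v) (to , from) 𝒫′
    where
      to : attachAll (EdgeIn _) _ N ⇒ EdgeIn _
      to e = edgeIn-resp (≐-sym S≐S′∪v) (edgeIn-insert⁺ nbrs (attachAll⁻ N e))
      from : EdgeIn _ ⇒ attachAll (EdgeIn _) _ N
      from e = attachAll⁺ N (edgeIn-insert⁻ nbrs (edgeIn-resp S≐S′∪v e))

  induced : Subset n → Subgraph G
  induced p = record
    { inS     = λ x → ⌊ x ∈? p ⌋
    ; hadj    = λ x y → ⌊ edgeIn? x y ⌋
    ; hsymm   = edgeIn?-sym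
    ; hsub    = λ x y e → proj₂ (proj₂ (toWitness e))
    ; hclosed = λ x y e → let x∈p , y∈p , _ = toWitness e in fromWitness x∈p , fromWitness y∈p
    }
    where
      edgeIn? : ∀ x y → Dec (EdgeIn (_∈ₛ p) x y)
      edgeIn? x y = (x ∈? p) ×-dec (y ∈? p) ×-dec T? (adj G x y)

      edgeIn?-sym : ∀ x y → ⌊ edgeIn? x y ⌋ ≡ ⌊ edgeIn? y x ⌋
      edgeIn?-sym x y = begin
        ⌊ edgeIn? x y ⌋     ≡⟨ isYes≗does (edgeIn? x y) ⟩
        does (edgeIn? x y)  ≡⟨ does-⇔ (mk⇔ edgeIn-sym edgeIn-sym) (edgeIn? x y) (edgeIn? y x) ⟩
        does (edgeIn? y x)  ≡⟨ isYes≗does (edgeIn? y x) ⟨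
        ⌊ edgeIn? y x ⌋     ∎
        where open ≡-Reasoning

  neighboursIn : Subset n → V → List V
  neighboursIn p v = filterᵇ (hadj (induced p) v) (allFin n)

  neighboursIn-unique : ∀ p v → Unique (neighboursIn p v)
  neighboursIn-unique p v = Unique.filter⁺ (T? ∘ hadj (induced p) v) (Unique.allFin⁺ n)

  neighboursIn-lists : ∀ {p v} → v ∈ₛ p → ListsNeighbours (_∈ₛ p - v) v (neighboursIn p v)
  neighboursIn-lists {p} {v} v∈p = record { neighbour⁺ = neighbour⁺′ ; neighbour⁻ = neighbour⁻′ }
    where
      neighbour⁺′ : ∀ {z} → z ∈ₛ p - v → Adj v z → z ∈ neighboursIn p v
      neighbour⁺′ {z} z∈p-v a = ∈-filter⁺ (T? ∘ hadj (induced p) v) (∈-allFin z)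
                                  (fromWitness (v∈p , p─q⊆p p ⁅ v ⁆ z∈p-v , a))
      neighbour⁻′ : ∀ {z} → z ∈ neighboursIn p v → z ∈ₛ p - v × Adj v z
      neighbour⁻′ z∈N with toWitness (proj₂ (∈-filter⁻ (T? ∘ hadj (induced p) v) {xs = allFin n} z∈N))
      ... | _ , z∈p , a = x∈p∧x≢y⇒x∈p-y z∈p (λ { refl → adj-irrefl a }) , a

  separatingSystem-induced : TwoDegenerate G → (p : Subset n) → Acc _⊂_ p →
                             ∃ λ m → m ≤ ∣ p ∣ × Σ (Fin m → List V) (SeparatingSystem (_∈ₛ p) (EdgeIn (_∈ₛ p)))
  separatingSystem-induced td p (acc smaller) with nonempty? p
  ... | no p-empty =
    0 , z≤n , Vector.[] , emptySystem (λ x∈p → p-empty (_ , x∈p)) (λ (x∈p , _) → p-empty (_ , x∈p))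
  ... | yes (x , x∈p) with td (induced p) (x , fromWitness x∈p)
  ...   | v , v∈ , deg≤2 =
    let v∈p = toWitness v∈
        m , m≤∣p-v∣ , sys , 𝒫 = separatingSystem-induced td (p - v) (smaller (x∈p⇒p-x⊂p v∈p))
        sys′ , 𝒫′ = vertexStep (x∈p⇒p≐p-x∪x v∈p) (x∉p-x p v) (neighboursIn p v) (neighboursIn-lists v∈p)
                               (neighboursIn-unique p v) deg≤2 𝒫
    in suc m , ≤-trans (s≤s m≤∣p-v∣) (x∈p⇒∣p-x∣<∣p∣ v∈p) , sys′ , 𝒫′

  toPath : ∀ {p} → IsPathIn S (EdgeIn S) p → Path G
  toPath {p = p} P = record
    { verts    = p
    ; nonempty = nonempty P
    ; distinct = distinct P
    ; linked   = Linked.map (proj₂ ∘ proj₂) (linked P)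
    }

  separatingSystem⇒sspAtMost : {sys : Fin m → List V} → (∀ x → S x) →
                               SeparatingSystem S (EdgeIn S) sys → SspAtMost G m
  separatingSystem⇒sspAtMost S-all 𝒫 = 𝒫s , stronglySeparating , ≤-reflexive (length-tabulate _)
    where
      𝒫s : List (Path G)
      𝒫s = tabulate (toPath ∘ isPath 𝒫)

      separated : ∀ (e f : Edge G) → proj₁ e ≢ proj₁ f →
                  Any (λ P → ContainsEdge P e × ¬ ContainsEdge P f) 𝒫s
      separated ((u , w) , u<w , a) ((u′ , w′) , u′<w′ , a′) e≢f =
        let l , c , ¬c = separates 𝒫 (S-all u , S-all w , a) (S-all u′ , S-all w′ , a′) different in
        Any.tabulate⁺ l (c , ¬c)
        where
          different : ¬ SamePair u w u′ w′
          different (inj₁ (refl , refl)) = e≢f refl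
          different (inj₂ (refl , refl)) = <-asym u<w u′<w′

      stronglySeparating : StronglySeparating 𝒫s
      stronglySeparating e f e≢f = separated e f e≢f , separated f e (e≢f ∘ sym)

theorem1p1 : (n : ℕ) (G : Graph n) → TwoDegenerate G → SspAtMost G n
theorem1p1 n G td =
  let m , m≤∣⊤∣ , _ , 𝒫 = separatingSystem-induced G td ⊤ (⊂-wellFounded ⊤)
      𝒫s , separating , length≤m = separatingSystem⇒sspAtMost G (λ _ → ∈⊤) 𝒫
  in 𝒫s , separating , ≤-trans length≤m (subst (m ≤_) (∣⊤∣≡n n) m≤∣⊤∣)
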